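{- Let $M=(m_i)_{i=0}^{\infty}$ be a sequence of integers with $m_0=1$ and $m_i\ge 2$ for $i\ge 1$, and let $M'=(1,m_2,m_3,\ldots)$. For an integer $a\ge0$ let $f(a,t)=\frac{t^a-1}{t-1}$. Let $n=km_2+r$ with integers $k\ge0$ and $r\in\{0,1,\ldots,m_2-1\}$. Then \[ p_M(m_1n,t)\equiv t^{r}f(r+1,t^{m_1-1})\,p_{M'}(km_2,t)\pmod{t^{m_1+m_2-1}f(m_2,t^{m_1-1})}. \]
   Context: For a sequence $N=(n_i)_{i\ge0}$ of integers with $n_0=1$ and $n_i\ge2$ for $i\ge1$, let $N_i=\prod_{j=0}^{i}n_j$ and define $p_N(n,t)\in\mathbb{Z}[t]$ by $\prod_{i=0}^{\infty}\frac{1}{1-tq^{N_i}}=\sum_{n=0}^{\infty}p_N(n,t)q^n$. Congruence is divisibility of the difference in $\mathbb{Z}[t]$. -}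

module Defs where

open import Data.Nat as ℕ using (ℕ; zero; suc; _∸_; _≟_)
open import Data.Integer as ℤ using (ℤ; 0ℤ; 1ℤ)
open import Data.List using (List; []; _∷_; map; replicate; _++_)
open import Data.Product using (∃)
open import Relation.Nullary using (yes; no)
open import Relation.Binary.PropositionalEquality using (_≡_)

-- Polynomials in ℤ[t], as coefficient lists (constant term first).

Poly : Set
Poly = List ℤ

coeff : Poly → ℕ → ℤ
coeff []      _       = 0ℤ
coeff (a ∷ p) zero    = a
coeff (a ∷ p) (suc i) = coeff p i

infixl 6 _+ₚ_ _-ₚ_
infixl 7 _*ₚ_

_+ₚ_ : Poly → Poly → Poly
[]      +ₚ q       = q
(a ∷ p) +ₚ []      = a ∷ p
(a ∷ p) +ₚ (b ∷ q) = (a ℤ.+ b) ∷ (p +ₚ q)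

negₚ : Poly → Poly
negₚ = map (λ a → ℤ.- a)

_-ₚ_ : Poly → Poly → Poly
p -ₚ q = p +ₚ negₚ q

_*ₚ_ : Poly → Poly → Poly
[]      *ₚ q = []
(a ∷ p) *ₚ q = map (a ℤ.*_) q +ₚ (0ℤ ∷ (p *ₚ q))

tpow : ℕ → Poly
tpow n = replicate n 0ℤ ++ (1ℤ ∷ [])

-- equality of polynomials (coefficientwise; trailing zeros irrelevant)
_≈ₚ_ : Poly → Poly → Set
p ≈ₚ q = ∀ i → coeff p i ≡ coeff q i

_∣ₚ_ : Poly → Poly → Set
p ∣ₚ q = ∃ λ r → q ≈ₚ (p *ₚ r)

_≡_[modₚ_] : Poly → Poly → Poly → Set
p ≡ q [modₚ m ] = m ∣ₚ (p -ₚ q)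

-- Σ_{j<a} t^{s·j}, i.e. f(a, t^s) where f(a,x) = (x^a - 1)/(x - 1)
fgeom : ℕ → ℕ → Poly
fgeom zero    s = []
fgeom (suc a) s = fgeom a s +ₚ tpow (s ℕ.* a)

-- Power series in q with coefficients in ℤ[t], as ℕ → Poly.

Series : Set
Series = ℕ → Poly

sumₚ : (ℕ → Poly) → ℕ → Poly
sumₚ f zero    = []
sumₚ f (suc n) = sumₚ f n +ₚ f n

_*ₛ_ : Series → Series → Series
(A *ₛ B) n = sumₚ (λ k → A k *ₚ B (n ∸ k)) (suc n)

-- 1/(1 - t q^d) = Σ_c t^c q^{c d}; coefficient of q^n
geomS : ℕ → Series
geomS d n = sumₚ (λ c → indicator c) (suc n)
  where
  indicator : ℕ → Poly
  indicator c with c ℕ.* d ≟ n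
  ... | yes _ = tpow c
  ... | no  _ = []

Nprod : (ℕ → ℕ) → ℕ → ℕ
Nprod N zero    = N zero
Nprod N (suc i) = Nprod N i ℕ.* N (suc i)

prodGeom : (ℕ → ℕ) → ℕ → Series
prodGeom N zero    = geomS (Nprod N zero)
prodGeom N (suc j) = prodGeom N j *ₛ geomS (Nprod N (suc j))

-- p_N(n,t): coefficient of q^n in ∏_{i≥0} 1/(1 - t q^{N_i}).
-- Factors with i > n have N_i ≥ 2^i > n and contribute only 1 to
-- the coefficient of q^n, so truncating the product at i = n is exact.
pN : (ℕ → ℕ) → ℕ → Poly
pN N n = prodGeom N n n

shiftSeq : (ℕ → ℕ) → ℕ → ℕ
shiftSeq M zero    = 1
shiftSeq M (suc i) = M (suc (suc i))

{-# OPTIONS --safe #-}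
-- Write P_N(q) = ∏ᵢ 1/(1 - t q^{N_i}) = Σₙ p_N(n,t) qⁿ. Since M_i = m₁ M′_{i-1} for i ≥ 1,
-- P_M(q) = P_{M′}(q^{m₁})/(1 - t q), which on multiples of m₁ reads
--   p_M(m₁(n+1)) = p_{M′}(n+1) + t^{m₁} p_M(m₁ n);
-- likewise P_{M′}(q) = H(q^{m₂})/(1 - t q), so p_{M′}(k m₂ + r) = t^r p_{M′}(k m₂) for r < m₂.
-- Running the first recurrence through r = 0, 1, …, m₂ - 1 builds up t^r f(r+1, t^{m₁-1}) p_{M′}(k m₂),
-- since t^{m₁} = t · t^{m₁-1}; when r wraps around to 0 the term carried over is
-- t^{m₁+m₂-1} f(m₂, t^{m₁-1}) p_{M′}(k m₂), a multiple of the modulus.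
-- Both identities hold for the truncated products ∏_{i≤j}, which agree with the full product
-- up to q^j; there Y = X/(1 - t q^d) is the recurrence Y_x = X_x + t Y_{x-d}.

module Submission where

open import Defs
open import Algebra.Bundles using (CommutativeRing; CommutativeSemigroup)
open import Algebra.Structures using (IsCommutativeMonoid)
import Algebra.Properties.CommutativeSemigroup as CommSemigroupProperties
open import Data.Integer as ℤ using (ℤ; 0ℤ; 1ℤ)
import Data.Integer.Properties as ℤP
open import Data.List using ([]; _∷_; map)
open import Data.Maybe using (Maybe; nothing; just)
open import Data.Nat as ℕ using (ℕ; zero; suc; _+_; _*_; _∸_; _≤_; _<_; z≤n; s≤s; _≟_; _<?_)
open import Data.Nat.Divisibility using (_∣_; divides; _∣?_; n∣m*n; ∣m⇒∣m*n)
open import Data.Nat.Induction using (<-rec)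
import Data.Nat.Properties as ℕP
open import Data.Product using (Σ; _,_; proj₁)
open import Data.Sum using (inj₁; inj₂)
open import Function using (_∘_)
open import Level using (0ℓ)
open import Relation.Binary.Bundles using (Preorder)
import Relation.Binary.Reasoning.Preorder
import Relation.Binary.Reasoning.Setoid
open import Relation.Binary.Structures using (IsEquivalence)
open import Relation.Binary.PropositionalEquality using (_≡_; _≢_; refl; sym; trans; cong; cong₂; subst)
open import Relation.Nullary using (yes; no; contradiction)
open import Tactic.RingSolver using (solve-∀)
open import Tactic.RingSolver.Core.AlmostCommutativeRing using (AlmostCommutativeRing; fromCommutativeRing)

-- The ring ℤ[t]

-- Boxing _≈ₚ_ (a function type) in a record keeps p and q inferable
-- from a proof, and lets the ring solver recognise the relation.
infix 4 _≈_
record _≈_ (p q : Poly) : Set where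
  constructor mk≈
  field coeff-≡ : p ≈ₚ q
open _≈_

≈-refl : ∀ {p} → p ≈ p
≈-refl = mk≈ λ _ → refl

≈-sym : ∀ {p q} → p ≈ q → q ≈ p
≈-sym p≈q = mk≈ λ i → sym (coeff-≡ p≈q i)

≈-trans : ∀ {p q r} → p ≈ q → q ≈ r → p ≈ r
≈-trans p≈q q≈r = mk≈ λ i → trans (coeff-≡ p≈q i) (coeff-≡ q≈r i)

≈-reflexive : ∀ {p q} → p ≡ q → p ≈ q
≈-reflexive refl = ≈-refl

≈-isEquivalence : IsEquivalence _≈_
≈-isEquivalence = record { refl = ≈-refl ; sym = ≈-sym ; trans = ≈-trans }

∷-cong : ∀ {a b p q} → a ≡ b → p ≈ q → a ∷ p ≈ b ∷ q
∷-cong a≡b p≈q = mk≈ λ { zero → a≡b ; (suc i) → coeff-≡ p≈q i }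

0∷-≈[] : ∀ {p} → p ≈ [] → 0ℤ ∷ p ≈ []
0∷-≈[] p≈[] = mk≈ λ { zero → refl ; (suc i) → coeff-≡ p≈[] i }

coeff-+ₚ : ∀ p q i → coeff (p +ₚ q) i ≡ coeff p i ℤ.+ coeff q i
coeff-+ₚ []      q       i       = sym (ℤP.+-identityˡ _)
coeff-+ₚ (a ∷ p) []      i       = sym (ℤP.+-identityʳ _)
coeff-+ₚ (a ∷ p) (b ∷ q) zero    = refl
coeff-+ₚ (a ∷ p) (b ∷ q) (suc i) = coeff-+ₚ p q i

coeff-negₚ : ∀ p i → coeff (negₚ p) i ≡ ℤ.- coeff p i
coeff-negₚ []      i       = refl
coeff-negₚ (a ∷ p) zero    = refl
coeff-negₚ (a ∷ p) (suc i) = coeff-negₚ p i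

+ₚ-cong : ∀ {p p′ q q′} → p ≈ p′ → q ≈ q′ → p +ₚ q ≈ p′ +ₚ q′
+ₚ-cong {p} {p′} {q} {q′} p≈p′ q≈q′ = mk≈ λ i →
  trans (coeff-+ₚ p q i)
        (trans (cong₂ ℤ._+_ (coeff-≡ p≈p′ i) (coeff-≡ q≈q′ i)) (sym (coeff-+ₚ p′ q′ i)))

+ₚ-congˡ : ∀ {p p′} q → p ≈ p′ → p +ₚ q ≈ p′ +ₚ q
+ₚ-congˡ q p≈p′ = +ₚ-cong p≈p′ (≈-refl {q})

+ₚ-congʳ : ∀ p {q q′} → q ≈ q′ → p +ₚ q ≈ p +ₚ q′
+ₚ-congʳ p q≈q′ = +ₚ-cong (≈-refl {p}) q≈q′

+ₚ-comm : ∀ p q → p +ₚ q ≈ q +ₚ p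
+ₚ-comm []      []      = ≈-refl
+ₚ-comm []      (b ∷ q) = ≈-refl
+ₚ-comm (a ∷ p) []      = ≈-refl
+ₚ-comm (a ∷ p) (b ∷ q) = ∷-cong (ℤP.+-comm a b) (+ₚ-comm p q)

+ₚ-assoc : ∀ p q r → (p +ₚ q) +ₚ r ≈ p +ₚ (q +ₚ r)
+ₚ-assoc []      q       r       = ≈-refl
+ₚ-assoc (a ∷ p) []      r       = ≈-refl
+ₚ-assoc (a ∷ p) (b ∷ q) []      = ≈-refl
+ₚ-assoc (a ∷ p) (b ∷ q) (c ∷ r) = ∷-cong (ℤP.+-assoc a b c) (+ₚ-assoc p q r)

+ₚ-identityʳ : ∀ p → p +ₚ [] ≈ p
+ₚ-identityʳ []      = ≈-refl
+ₚ-identityʳ (a ∷ p) = ≈-refl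

negₚ-cong : ∀ {p q} → p ≈ q → negₚ p ≈ negₚ q
negₚ-cong {p} {q} p≈q = mk≈ λ i →
  trans (coeff-negₚ p i) (trans (cong ℤ.-_ (coeff-≡ p≈q i)) (sym (coeff-negₚ q i)))

negₚ-inverseˡ : ∀ p → negₚ p +ₚ p ≈ []
negₚ-inverseˡ []      = ≈-refl
negₚ-inverseˡ (a ∷ p) = mk≈ λ
  { zero    → ℤP.+-inverseˡ a
  ; (suc i) → coeff-≡ (negₚ-inverseˡ p) i }

negₚ-inverseʳ : ∀ p → p +ₚ negₚ p ≈ []
negₚ-inverseʳ p = ≈-trans (+ₚ-comm p (negₚ p)) (negₚ-inverseˡ p)

+ₚ-isCommutativeMonoid : IsCommutativeMonoid _≈_ _+ₚ_ []
+ₚ-isCommutativeMonoid = record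
  { isMonoid = record
    { isSemigroup = record
      { isMagma = record
        { isEquivalence = ≈-isEquivalence
        ; ∙-cong = +ₚ-cong }
      ; assoc = +ₚ-assoc }
    ; identity = (λ _ → ≈-refl) , +ₚ-identityʳ }
  ; comm = +ₚ-comm }

+ₚ-commutativeSemigroup : CommutativeSemigroup 0ℓ 0ℓ
+ₚ-commutativeSemigroup = record
  { isCommutativeSemigroup = IsCommutativeMonoid.isCommutativeSemigroup +ₚ-isCommutativeMonoid }

open CommSemigroupProperties +ₚ-commutativeSemigroup using (interchange; x∙yz≈y∙xz)

scale : ℤ → Poly → Poly
scale a = map (a ℤ.*_)

scale-cong : ∀ a {p q} → p ≈ q → scale a p ≈ scale a q
scale-cong a {p} {q} p≈q = mk≈ λ i →
  trans (coeff-scale p i) (trans (cong (a ℤ.*_) (coeff-≡ p≈q i)) (sym (coeff-scale q i)))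
  where
  coeff-scale : ∀ p i → coeff (scale a p) i ≡ a ℤ.* coeff p i
  coeff-scale []      i       = sym (ℤP.*-zeroʳ a)
  coeff-scale (b ∷ p) zero    = refl
  coeff-scale (b ∷ p) (suc i) = coeff-scale p i

scale-+ₚ : ∀ a p q → scale a (p +ₚ q) ≈ scale a p +ₚ scale a q
scale-+ₚ a []      q       = ≈-refl
scale-+ₚ a (b ∷ p) []      = ≈-refl
scale-+ₚ a (b ∷ p) (c ∷ q) = ∷-cong (ℤP.*-distribˡ-+ a b c) (scale-+ₚ a p q)

scale-scale : ∀ a b p → scale (a ℤ.* b) p ≈ scale a (scale b p)
scale-scale a b []      = ≈-refl
scale-scale a b (c ∷ p) = ∷-cong (ℤP.*-assoc a b c) (scale-scale a b p)

scale-1 : ∀ p → scale 1ℤ p ≈ p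
scale-1 []      = ≈-refl
scale-1 (a ∷ p) = ∷-cong (ℤP.*-identityˡ a) (scale-1 p)

scale-0 : ∀ p → scale 0ℤ p ≈ []
scale-0 []      = ≈-refl
scale-0 (a ∷ p) = 0∷-≈[] (scale-0 p)

scale-0∷ : ∀ a p → scale a (0ℤ ∷ p) ≈ 0ℤ ∷ scale a p
scale-0∷ a p = ∷-cong (ℤP.*-zeroʳ a) ≈-refl

*ₚ-congʳ : ∀ p {q q′} → q ≈ q′ → p *ₚ q ≈ p *ₚ q′
*ₚ-congʳ []      q≈q′ = ≈-refl
*ₚ-congʳ (a ∷ p) q≈q′ = +ₚ-cong (scale-cong a q≈q′) (∷-cong refl (*ₚ-congʳ p q≈q′))

*ₚ-zeroʳ : ∀ p → p *ₚ [] ≈ []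
*ₚ-zeroʳ []      = ≈-refl
*ₚ-zeroʳ (a ∷ p) = 0∷-≈[] (*ₚ-zeroʳ p)

*ₚ-∷ : ∀ p b q → p *ₚ (b ∷ q) ≈ scale b p +ₚ (0ℤ ∷ p *ₚ q)
*ₚ-∷ []      b q = ≈-sym (0∷-≈[] ≈-refl)
*ₚ-∷ (a ∷ p) b q = ∷-cong (cong (ℤ._+ 0ℤ) (ℤP.*-comm a b))
  (≈-trans (+ₚ-congʳ (scale a q) (*ₚ-∷ p b q)) (x∙yz≈y∙xz (scale a q) (scale b p) (0ℤ ∷ p *ₚ q)))

*ₚ-comm : ∀ p q → p *ₚ q ≈ q *ₚ p
*ₚ-comm []      q = ≈-sym (*ₚ-zeroʳ q)
*ₚ-comm (a ∷ p) q = ≈-sym (≈-trans (*ₚ-∷ q a p) (+ₚ-congʳ (scale a q) (∷-cong refl (*ₚ-comm q p))))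

*ₚ-congˡ : ∀ {p p′} q → p ≈ p′ → p *ₚ q ≈ p′ *ₚ q
*ₚ-congˡ {p} {p′} q p≈p′ = ≈-trans (*ₚ-comm p q) (≈-trans (*ₚ-congʳ q p≈p′) (*ₚ-comm q p′))

*ₚ-cong : ∀ {p p′ q q′} → p ≈ p′ → q ≈ q′ → p *ₚ q ≈ p′ *ₚ q′
*ₚ-cong {p′ = p′} {q} p≈p′ q≈q′ = ≈-trans (*ₚ-congˡ q p≈p′) (*ₚ-congʳ p′ q≈q′)

*ₚ-distribˡ : ∀ p q r → p *ₚ (q +ₚ r) ≈ p *ₚ q +ₚ p *ₚ r
*ₚ-distribˡ []      q r = ≈-refl
*ₚ-distribˡ (a ∷ p) q r =
  ≈-trans (+ₚ-cong (scale-+ₚ a q r) (∷-cong refl (*ₚ-distribˡ p q r)))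
          (interchange (scale a q) (scale a r) (0ℤ ∷ p *ₚ q) (0ℤ ∷ p *ₚ r))

*ₚ-distribʳ : ∀ r p q → (p +ₚ q) *ₚ r ≈ p *ₚ r +ₚ q *ₚ r
*ₚ-distribʳ r p q =
  ≈-trans (*ₚ-comm (p +ₚ q) r)
          (≈-trans (*ₚ-distribˡ r p q) (+ₚ-cong (*ₚ-comm r p) (*ₚ-comm r q)))

0∷-*ₚ : ∀ p q → (0ℤ ∷ p) *ₚ q ≈ 0ℤ ∷ p *ₚ q
0∷-*ₚ p q = +ₚ-congˡ (0ℤ ∷ p *ₚ q) (scale-0 q)

scale-*ₚ : ∀ a p q → scale a p *ₚ q ≈ scale a (p *ₚ q)
scale-*ₚ a []      q = ≈-refl
scale-*ₚ a (b ∷ p) q = ≈-trans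
  (+ₚ-cong (scale-scale a b q) (∷-cong refl (scale-*ₚ a p q)))
  (≈-sym (≈-trans (scale-+ₚ a (scale b q) (0ℤ ∷ p *ₚ q)) (+ₚ-congʳ _ (scale-0∷ a (p *ₚ q)))))

*ₚ-assoc : ∀ p q r → (p *ₚ q) *ₚ r ≈ p *ₚ (q *ₚ r)
*ₚ-assoc []      q r = ≈-refl
*ₚ-assoc (a ∷ p) q r = ≈-trans (*ₚ-distribʳ r (scale a q) (0ℤ ∷ p *ₚ q))
  (+ₚ-cong (scale-*ₚ a q r) (≈-trans (0∷-*ₚ (p *ₚ q) r) (∷-cong refl (*ₚ-assoc p q r))))

1ₚ : Poly
1ₚ = 1ℤ ∷ []

*ₚ-identityˡ : ∀ p → 1ₚ *ₚ p ≈ p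
*ₚ-identityˡ p = ≈-trans (+ₚ-cong (scale-1 p) (0∷-≈[] ≈-refl)) (+ₚ-identityʳ p)

*ₚ-identityʳ : ∀ p → p *ₚ 1ₚ ≈ p
*ₚ-identityʳ p = ≈-trans (*ₚ-comm p 1ₚ) (*ₚ-identityˡ p)

ℤ[t] : CommutativeRing 0ℓ 0ℓ
ℤ[t] = record
  { Carrier = Poly ; _≈_ = _≈_ ; _+_ = _+ₚ_ ; _*_ = _*ₚ_ ; -_ = negₚ ; 0# = [] ; 1# = 1ₚ
  ; isCommutativeRing = record
    { isRing = record
      { +-isAbelianGroup = record
        { isGroup = record
          { isMonoid = IsCommutativeMonoid.isMonoid +ₚ-isCommutativeMonoid
          ; inverse = negₚ-inverseˡ , negₚ-inverseʳ
          ; ⁻¹-cong = negₚ-cong }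
        ; comm = +ₚ-comm }
      ; *-cong = *ₚ-cong
      ; *-assoc = *ₚ-assoc
      ; *-identity = *ₚ-identityˡ , *ₚ-identityʳ
      ; distrib = *ₚ-distribˡ , *ₚ-distribʳ }
    ; *-comm = *ₚ-comm } }

ℤ[t]-solver : AlmostCommutativeRing 0ℓ 0ℓ
ℤ[t]-solver = fromCommutativeRing ℤ[t] ≈[]?
  where
  ≈[]? : ∀ p → Maybe ([] ≈ p)
  ≈[]? []      = just ≈-refl
  ≈[]? (a ∷ p) with a ℤ.≟ 0ℤ | ≈[]? p
  ... | yes refl | just []≈p = just (≈-sym (0∷-≈[] (≈-sym []≈p)))
  ... | _        | _         = nothing

module ≈-Reasoning = Relation.Binary.Reasoning.Setoid (CommutativeRing.setoid ℤ[t])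

t : Poly
t = tpow 1

t-*ₚ : ∀ p → t *ₚ p ≈ 0ℤ ∷ p
t-*ₚ p = ≈-trans (0∷-*ₚ 1ₚ p) (∷-cong refl (*ₚ-identityˡ p))

tpow-suc : ∀ a → tpow (suc a) ≈ t *ₚ tpow a
tpow-suc a = ≈-sym (t-*ₚ (tpow a))

tpow-+ : ∀ a b → tpow (a + b) ≈ tpow a *ₚ tpow b
tpow-+ zero    b = ≈-sym (*ₚ-identityˡ (tpow b))
tpow-+ (suc a) b = ≈-trans (∷-cong refl (tpow-+ a b)) (≈-sym (0∷-*ₚ (tpow a) (tpow b)))

fgeom-1 : ∀ s → fgeom 1 s ≈ 1ₚ
fgeom-1 s rewrite ℕP.*-zeroʳ s = ≈-refl

fgeom-suc : ∀ a s → fgeom (suc a) s ≈ 1ₚ +ₚ tpow s *ₚ fgeom a s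
fgeom-suc zero    s = ≈-trans (fgeom-1 s) (≈-sym (+ₚ-congʳ 1ₚ (*ₚ-zeroʳ (tpow s))))
fgeom-suc (suc a) s = begin
  fgeom (suc a) s +ₚ tpow (s * suc a)
    ≈⟨ +ₚ-cong (fgeom-suc a s) (≈-trans (≈-reflexive (cong tpow (ℕP.*-suc s a))) (tpow-+ s (s * a))) ⟩
  (1ₚ +ₚ tpow s *ₚ fgeom a s) +ₚ tpow s *ₚ tpow (s * a)
    ≈⟨ factor 1ₚ (tpow s) (fgeom a s) (tpow (s * a)) ⟩
  1ₚ +ₚ tpow s *ₚ (fgeom a s +ₚ tpow (s * a)) ∎
  where
  open ≈-Reasoning
  factor : ∀ u x p q → (u +ₚ x *ₚ p) +ₚ x *ₚ q ≈ u +ₚ x *ₚ (p +ₚ q)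
  factor = solve-∀ ℤ[t]-solver

-- Congruence modulo a polynomial

-- The relation _≡_[modₚ_] of Defs, boxed for the same reason as _≈_.
infix 4 _≡_[mod_]
record _≡_[mod_] (p q m : Poly) : Set where
  constructor mk≡mod
  field
    multiplier : Poly
    difference : p -ₚ q ≈ m *ₚ multiplier

≡[mod]⇒≡[modₚ] : ∀ {p q m} → p ≡ q [mod m ] → p ≡ q [modₚ m ]
≡[mod]⇒≡[modₚ] (mk≡mod w p-q≈mw) = w , coeff-≡ p-q≈mw

module _ {m : Poly} where

  ≈⇒≡-mod : ∀ {p q} → p ≈ q → p ≡ q [mod m ]
  ≈⇒≡-mod {p} {q} p≈q = mk≡mod [] (≈-trans (+ₚ-congˡ (negₚ q) p≈q) (cancel q m))
    where
    cancel : ∀ q m → q -ₚ q ≈ m *ₚ []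
    cancel = solve-∀ ℤ[t]-solver

  ≡-mod-trans : ∀ {p q r} → p ≡ q [mod m ] → q ≡ r [mod m ] → p ≡ r [mod m ]
  ≡-mod-trans {p} {q} {r} (mk≡mod v p-q≈mv) (mk≡mod w q-r≈mw) = mk≡mod (v +ₚ w)
    (≈-trans (telescope p q r) (≈-trans (+ₚ-cong p-q≈mv q-r≈mw) (≈-sym (*ₚ-distribˡ m v w))))
    where
    telescope : ∀ p q r → p -ₚ r ≈ (p -ₚ q) +ₚ (q -ₚ r)
    telescope = solve-∀ ℤ[t]-solver

  ≡-mod-+ₚ-congʳ : ∀ u {p q} → p ≡ q [mod m ] → u +ₚ p ≡ u +ₚ q [mod m ]
  ≡-mod-+ₚ-congʳ u {p} {q} (mk≡mod w p-q≈mw) = mk≡mod w (≈-trans (cancel u p q) p-q≈mw)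
    where
    cancel : ∀ u p q → (u +ₚ p) -ₚ (u +ₚ q) ≈ p -ₚ q
    cancel = solve-∀ ℤ[t]-solver

  ≡-mod-*ₚ-congʳ : ∀ u {p q} → p ≡ q [mod m ] → u *ₚ p ≡ u *ₚ q [mod m ]
  ≡-mod-*ₚ-congʳ u {p} {q} (mk≡mod w p-q≈mw) = mk≡mod (u *ₚ w)
    (≈-trans (factor u p q) (≈-trans (*ₚ-congʳ u p-q≈mw) (swap u m w)))
    where
    factor : ∀ u p q → u *ₚ p -ₚ u *ₚ q ≈ u *ₚ (p -ₚ q)
    factor = solve-∀ ℤ[t]-solver
    swap : ∀ u m w → u *ₚ (m *ₚ w) ≈ m *ₚ (u *ₚ w)
    swap = solve-∀ ℤ[t]-solver

  +ₚ-multiple-≡-mod : ∀ p w → p +ₚ m *ₚ w ≡ p [mod m ]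
  +ₚ-multiple-≡-mod p w = mk≡mod w (cancel p (m *ₚ w))
    where
    cancel : ∀ p q → (p +ₚ q) -ₚ p ≈ q
    cancel = solve-∀ ℤ[t]-solver

≡-mod-preorder : Poly → Preorder 0ℓ 0ℓ 0ℓ
≡-mod-preorder m = record
  { _≈_ = _≈_
  ; _≲_ = _≡_[mod m ]
  ; isPreorder = record
    { isEquivalence = ≈-isEquivalence ; reflexive = ≈⇒≡-mod ; trans = ≡-mod-trans } }

-- Series and division by 1 - t qᵈ

sumₚ-cong : ∀ {f g : ℕ → Poly} n → (∀ k → k < n → f k ≈ g k) → sumₚ f n ≈ sumₚ g n
sumₚ-cong zero    f≈g = ≈-refl
sumₚ-cong (suc n) f≈g =
  +ₚ-cong (sumₚ-cong n λ k k<n → f≈g k (ℕP.m<n⇒m<1+n k<n)) (f≈g n ℕP.≤-refl)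

sumₚ-≈[] : ∀ {f : ℕ → Poly} n → (∀ k → k < n → f k ≈ []) → sumₚ f n ≈ []
sumₚ-≈[] zero    f≈[] = ≈-refl
sumₚ-≈[] (suc n) f≈[] =
  +ₚ-cong (sumₚ-≈[] n λ k k<n → f≈[] k (ℕP.m<n⇒m<1+n k<n)) (f≈[] n ℕP.≤-refl)

sumₚ-single : ∀ {f : ℕ → Poly} c n → c < n → (∀ k → k < n → k ≢ c → f k ≈ []) → sumₚ f n ≈ f c
sumₚ-single {f} c (suc n) (s≤s c≤n) others with c ≟ n
... | yes refl = +ₚ-congˡ (f c) (sumₚ-≈[] n λ k k<n → others k (ℕP.m<n⇒m<1+n k<n) (ℕP.<⇒≢ k<n))
... | no c≢n   = ≈-trans
  (+ₚ-cong (sumₚ-single c n (ℕP.≤∧≢⇒< c≤n c≢n) λ k k<n → others k (ℕP.m<n⇒m<1+n k<n))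
           (others n ℕP.≤-refl (c≢n ∘ sym)))
  (+ₚ-identityʳ (f c))

*ₚ-sumₚ : ∀ u (f : ℕ → Poly) n → u *ₚ sumₚ f n ≈ sumₚ (λ k → u *ₚ f k) n
*ₚ-sumₚ u f zero    = *ₚ-zeroʳ u
*ₚ-sumₚ u f (suc n) = ≈-trans (*ₚ-distribˡ u (sumₚ f n) (f n)) (+ₚ-congˡ (u *ₚ f n) (*ₚ-sumₚ u f n))

sumₚ-+ : ∀ (f : ℕ → Poly) a b → sumₚ f (a + b) ≈ sumₚ f a +ₚ sumₚ (λ i → f (a + i)) b
sumₚ-+ f a zero    rewrite ℕP.+-identityʳ a = ≈-sym (+ₚ-identityʳ (sumₚ f a))
sumₚ-+ f a (suc b) rewrite ℕP.+-suc a b =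
  ≈-trans (+ₚ-congˡ (f (a + b)) (sumₚ-+ f a b)) (+ₚ-assoc (sumₚ f a) _ (f (a + b)))

-- geomS d n is a sum whose terms are local to its definition; unification names them.
geomS-terms : ∀ d n → Σ (ℕ → Poly) λ f → geomS d n ≡ sumₚ f (suc n)
geomS-terms d n = _ , refl

geomS-term : ℕ → ℕ → ℕ → Poly
geomS-term d n = proj₁ (geomS-terms d n)

geomS-term-hit : ∀ d n c → c * d ≡ n → geomS-term d n c ≈ tpow c
geomS-term-hit d n c cd≡n with c * d ≟ n
... | yes _    = ≈-refl
... | no cd≢n = contradiction cd≡n cd≢n

geomS-term-miss : ∀ d n c → c * d ≢ n → geomS-term d n c ≈ []
geomS-term-miss d n c cd≢n with c * d ≟ n
... | yes cd≡n = contradiction cd≡n cd≢n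
... | no _     = ≈-refl

geomS-multiple : ∀ {d} → 0 < d → ∀ c → geomS d (c * d) ≈ tpow c
geomS-multiple {d@(suc _)} _ c = ≈-trans
  (sumₚ-single c (suc (c * d)) (s≤s (ℕP.m≤m*n c d))
    λ k _ k≢c → geomS-term-miss d (c * d) k (k≢c ∘ ℕP.*-cancelʳ-≡ k c d))
  (geomS-term-hit d (c * d) c refl)

geomS-nonmultiple : ∀ d n → (∀ c → c * d ≢ n) → geomS d n ≈ []
geomS-nonmultiple d n nonmultiple = sumₚ-≈[] (suc n) λ c _ → geomS-term-miss d n c (nonmultiple c)

geomS-zero : ∀ {d} → 0 < d → geomS d 0 ≈ 1ₚ
geomS-zero 0<d = geomS-multiple 0<d 0

geomS-below : ∀ {d n} → 0 < n → n < d → geomS d n ≈ []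
geomS-below {d} {n} 0<n n<d = geomS-nonmultiple d n nonmultiple
  where
  nonmultiple : ∀ c → c * d ≢ n
  nonmultiple zero    0≡n  = ℕP.<⇒≢ 0<n 0≡n
  nonmultiple (suc c) cd≡n = ℕP.<⇒≱ n<d (subst (d ≤_) cd≡n (ℕP.m≤m+n d (c * d)))

geomS-step : ∀ {d} → 0 < d → ∀ z → geomS d (d + z) ≈ t *ₚ geomS d z
geomS-step {d} 0<d z with d ∣? z
... | yes (divides c refl) = ≈-trans (geomS-multiple 0<d (suc c))
  (≈-trans (tpow-suc c) (*ₚ-congʳ t (≈-sym (geomS-multiple 0<d c))))
... | no d∤z = ≈-trans (geomS-nonmultiple d (d + z) nonmultiple)
  (≈-sym (≈-trans (*ₚ-congʳ t (geomS-nonmultiple d z (λ c z≡cd → d∤z (divides c (sym z≡cd)))))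
                  (*ₚ-zeroʳ t)))
  where
  nonmultiple : ∀ c → c * d ≢ d + z
  nonmultiple zero    0≡d+z = ℕP.<⇒≢ (ℕP.<-≤-trans 0<d (ℕP.m≤m+n d z)) 0≡d+z
  nonmultiple (suc c) cd≡d+z = d∤z (divides c (sym (ℕP.+-cancelˡ-≡ d _ _ cd≡d+z)))

geomS-1 : ∀ x → geomS 1 x ≈ tpow x
geomS-1 x = subst (λ y → geomS 1 y ≈ tpow x) (ℕP.*-identityʳ x) (geomS-multiple (s≤s z≤n) x)

1ₛ : Series
1ₛ zero    = 1ₚ
1ₛ (suc _) = []

-- Y = X / (1 - t qᵈ), i.e. Y - t qᵈ Y = X, read off coefficientwise.
record GeomQuotient (d : ℕ) (X Y : Series) : Set where
  field
    below : ∀ x → x < d → Y x ≈ X x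
    step  : ∀ x → Y (d + x) ≈ X (d + x) +ₚ t *ₚ Y x

geomS-geomQuotient : ∀ {d} → 0 < d → GeomQuotient d 1ₛ (geomS d)
geomS-geomQuotient {suc _} 0<d = record { below = below ; step = geomS-step 0<d }
  where
  below : ∀ x → x < _ → geomS _ x ≈ 1ₛ x
  below zero    _   = geomS-zero 0<d
  below (suc x) x<d = geomS-below (s≤s z≤n) x<d

*ₛ-geomS-below : ∀ {d} → 0 < d → ∀ X x → x < d → (X *ₛ geomS d) x ≈ X x
*ₛ-geomS-below {d} 0<d X x x<d = +ₚ-cong
  (sumₚ-≈[] x λ k k<x → ≈-trans
    (*ₚ-congʳ (X k) (geomS-below (ℕP.m<n⇒0<n∸m k<x) (ℕP.≤-<-trans (ℕP.m∸n≤m x k) x<d)))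
    (*ₚ-zeroʳ (X k)))
  (≈-trans (*ₚ-congʳ (X x) (subst (λ y → geomS d y ≈ 1ₚ) (sym (ℕP.n∸n≡0 x)) (geomS-zero 0<d)))
           (*ₚ-identityʳ (X x)))

-- Split Σ_{k ≤ d+y} X_k G_{d+y-k} at k = y: the early terms are t·(X *ₛ G)_y and
-- of the late ones only k = d + y survives.
*ₛ-geomS-step : ∀ {d} → 0 < d → ∀ X y → (X *ₛ geomS d) (d + y) ≈ X (d + y) +ₚ t *ₚ (X *ₛ geomS d) y
*ₛ-geomS-step {d@(suc d′)} 0<d X y = begin
  sumₚ F (suc (d + y))                            ≡⟨ cong (sumₚ F ∘ suc) (ℕP.+-comm d y) ⟩
  sumₚ F (suc y + d)                              ≈⟨ sumₚ-+ F (suc y) d ⟩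
  sumₚ F (suc y) +ₚ sumₚ (λ i → F (suc y + i)) d
    ≈⟨ +ₚ-cong (≈-trans (sumₚ-cong (suc y) early) (≈-sym (*ₚ-sumₚ t _ (suc y))))
               (sumₚ-single d′ d ℕP.≤-refl late) ⟩
  t *ₚ (X *ₛ G) y +ₚ F (suc y + d′)               ≈⟨ +ₚ-comm (t *ₚ (X *ₛ G) y) (F (suc y + d′)) ⟩
  F (suc y + d′) +ₚ t *ₚ (X *ₛ G) y               ≈⟨ +ₚ-congˡ _ last ⟩
  X (d + y) +ₚ t *ₚ (X *ₛ G) y                    ∎
  where
  open ≈-Reasoning
  G = geomS d
  F : ℕ → Poly
  F k = X k *ₚ G (d + y ∸ k)
  swap : ∀ u v w → u *ₚ (v *ₚ w) ≈ v *ₚ (u *ₚ w)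
  swap = solve-∀ ℤ[t]-solver
  early : ∀ k → k < suc y → F k ≈ t *ₚ (X k *ₚ G (y ∸ k))
  early k (s≤s k≤y) = ≈-trans
    (*ₚ-congʳ (X k) (subst (λ z → G z ≈ t *ₚ G (y ∸ k)) (sym (ℕP.+-∸-assoc d k≤y))
                           (geomS-step 0<d (y ∸ k))))
    (swap (X k) t (G (y ∸ k)))
  shifted : ∀ i → d + y ∸ (suc y + i) ≡ d′ ∸ i
  shifted i = trans (cong (_∸ (y + i)) (ℕP.+-comm d′ y)) (ℕP.[m+n]∸[m+o]≡n∸o y d′ i)
  late : ∀ i → i < d → i ≢ d′ → F (suc y + i) ≈ []
  late i (s≤s i≤d′) i≢d′ = ≈-trans
    (*ₚ-congʳ (X (suc y + i)) (subst (λ z → G z ≈ []) (sym (shifted i))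
      (geomS-below (ℕP.m<n⇒0<n∸m (ℕP.≤∧≢⇒< i≤d′ i≢d′)) (s≤s (ℕP.m∸n≤m d′ i)))))
    (*ₚ-zeroʳ (X (suc y + i)))
  last : F (suc y + d′) ≈ X (d + y)
  last = ≈-trans
    (*ₚ-congʳ (X (suc y + d′)) (subst (λ z → G z ≈ 1ₚ) (sym (trans (shifted d′) (ℕP.n∸n≡0 d′)))
                                      (geomS-zero 0<d)))
    (subst (λ z → X (suc y + d′) *ₚ 1ₚ ≈ X z) (cong suc (ℕP.+-comm y d′)) (*ₚ-identityʳ _))

*ₛ-geomS-geomQuotient : ∀ {d} → 0 < d → ∀ X → GeomQuotient d X (X *ₛ geomS d)
*ₛ-geomS-geomQuotient 0<d X = record { below = *ₛ-geomS-below 0<d X ; step = *ₛ-geomS-step 0<d X }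

stride-induction : ∀ {ℓ} (P : ℕ → Set ℓ) {e} → 0 < e →
  (∀ n → n < e → P n) → (∀ n → P n → P (e + n)) → ∀ n → P n
stride-induction P {e} 0<e base step = <-rec P rec
  where
  rec : ∀ n → (∀ {m} → m < n → P m) → P n
  rec n smaller with n <? e
  ... | yes n<e = base n n<e
  ... | no n≮e with ℕP.m≤n⇒∃[o]m+o≡n (ℕP.≮⇒≥ n≮e)
  ...   | o , refl = step o (smaller (ℕP.m<n+m o 0<e))

n*m+r<e*m : ∀ {m n e r} → r < m → n < e → n * m + r < e * m
n*m+r<e*m {m} {n} {e} r<m n<e = ℕP.<-≤-trans (ℕP.+-monoʳ-< (n * m) r<m)
  (subst (_≤ e * m) (ℕP.+-comm m (n * m)) (ℕP.*-monoˡ-≤ m n<e))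

BlockGeometric : ℕ → Series → Set
BlockGeometric m X = ∀ n r → r < m → X (n * m + r) ≈ tpow r *ₚ X (n * m)

geomS-1-blockGeometric : ∀ m → BlockGeometric m (geomS 1)
geomS-1-blockGeometric m n r _ = begin
  geomS 1 (n * m + r)    ≈⟨ geomS-1 (n * m + r) ⟩
  tpow (n * m + r)       ≡⟨ cong tpow (ℕP.+-comm (n * m) r) ⟩
  tpow (r + n * m)       ≈⟨ tpow-+ r (n * m) ⟩
  tpow r *ₚ tpow (n * m) ≈⟨ *ₚ-congʳ (tpow r) (≈-sym (geomS-1 (n * m))) ⟩
  tpow r *ₚ geomS 1 (n * m) ∎
  where open ≈-Reasoning

geomQuotient-blockGeometric : ∀ {m d X Y} → m ∣ d → 0 < d →
  GeomQuotient d X Y → BlockGeometric m X → BlockGeometric m Y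
geomQuotient-blockGeometric {m} {_} {X} {Y} (divides e refl) 0<em Y≡X/ X-block =
  stride-induction P 0<e base stride
  where
  open GeomQuotient Y≡X/
  open ≈-Reasoning
  P : ℕ → Set
  P n = ∀ r → r < m → Y (n * m + r) ≈ tpow r *ₚ Y (n * m)
  0<e : 0 < e
  0<e = ℕP.n≢0⇒n>0 λ { refl → ℕP.<-irrefl refl 0<em }
  base : ∀ n → n < e → P n
  base n n<e r r<m = begin
    Y (n * m + r)        ≈⟨ below _ (n*m+r<e*m r<m n<e) ⟩
    X (n * m + r)        ≈⟨ X-block n r r<m ⟩
    tpow r *ₚ X (n * m)  ≈⟨ *ₚ-congʳ (tpow r) (≈-sym (below _ (ℕP.≤-<-trans (ℕP.m≤m+n (n * m) r) (n*m+r<e*m r<m n<e)))) ⟩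
    tpow r *ₚ Y (n * m)  ∎
  factor : ∀ u x s y → u *ₚ x +ₚ s *ₚ (u *ₚ y) ≈ u *ₚ (x +ₚ s *ₚ y)
  factor = solve-∀ ℤ[t]-solver
  stride : ∀ n → P n → P (e + n)
  stride n ih r r<m = begin
    Y ((e + n) * m + r)                              ≡⟨ cong Y (index r) ⟩
    Y (e * m + (n * m + r))                          ≈⟨ step (n * m + r) ⟩
    X (e * m + (n * m + r)) +ₚ t *ₚ Y (n * m + r)    ≡⟨ cong (λ x → X x +ₚ t *ₚ Y (n * m + r)) (sym (index r)) ⟩
    X ((e + n) * m + r) +ₚ t *ₚ Y (n * m + r)        ≈⟨ +ₚ-cong (X-block (e + n) r r<m) (*ₚ-congʳ t (ih r r<m)) ⟩
    tpow r *ₚ X ((e + n) * m) +ₚ t *ₚ (tpow r *ₚ Y (n * m)) ≈⟨ factor (tpow r) _ t _ ⟩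
    tpow r *ₚ (X ((e + n) * m) +ₚ t *ₚ Y (n * m))    ≡⟨ cong (λ x → tpow r *ₚ (X x +ₚ t *ₚ Y (n * m))) (ℕP.*-distribʳ-+ m e n) ⟩
    tpow r *ₚ (X (e * m + n * m) +ₚ t *ₚ Y (n * m))  ≈⟨ *ₚ-congʳ (tpow r) (≈-sym (step (n * m))) ⟩
    tpow r *ₚ Y (e * m + n * m)                      ≡⟨ cong (λ x → tpow r *ₚ Y x) (sym (ℕP.*-distribʳ-+ m e n)) ⟩
    tpow r *ₚ Y ((e + n) * m)                        ∎
    where
    index : ∀ r → (e + n) * m + r ≡ e * m + (n * m + r)
    index r = trans (cong (_+ r) (ℕP.*-distribʳ-+ m e n)) (ℕP.+-assoc (e * m) (n * m) r)

-- On multiples of m, X agrees with Z(qᵐ)/(1 - t q).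
record DilatedQuotient (m : ℕ) (Z X : Series) : Set where
  field
    at-zero : X 0 ≈ Z 0
    at-suc  : ∀ n → X (suc n * m) ≈ Z (suc n) +ₚ tpow m *ₚ X (n * m)

geomS-1-dilatedQuotient : ∀ m → DilatedQuotient m 1ₛ (geomS 1)
geomS-1-dilatedQuotient m = record
  { at-zero = geomS-zero {1} (s≤s z≤n)
  ; at-suc  = λ n → ≈-trans (geomS-1 (m + n * m))
      (≈-trans (tpow-+ m (n * m)) (*ₚ-congʳ (tpow m) (≈-sym (geomS-1 (n * m))))) }

module _ {m e : ℕ} {X Y Z W : Series} (0<m : 0 < m) (0<e : 0 < e)
         (Y≡X/ : GeomQuotient (e * m) X Y) (W≡Z/ : GeomQuotient e Z W) (X≡Z↑ : DilatedQuotient m Z X)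
         where

  private
    module Y = GeomQuotient Y≡X/
    module W = GeomQuotient W≡Z/
    open DilatedQuotient X≡Z↑
    open ≈-Reasoning
    T = tpow m

    Y≈X : ∀ {n} → n < e → Y (n * m) ≈ X (n * m)
    Y≈X n<e = Y.below _ (ℕP.*-monoˡ-< m {{ℕ.>-nonZero 0<m}} n<e)

  dilatedQuotient-zero : Y 0 ≈ W 0
  dilatedQuotient-zero = ≈-trans (Y≈X 0<e) (≈-trans at-zero (≈-sym (W.below 0 0<e)))

  dilatedQuotient-below : ∀ n → n < e → Y (suc n * m) ≈ W (suc n) +ₚ T *ₚ Y (n * m)
  dilatedQuotient-below n n<e with ℕP.m≤n⇒m<n∨m≡n n<e
  ... | inj₁ 1+n<e = begin
    Y (suc n * m)               ≈⟨ Y≈X 1+n<e ⟩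
    X (suc n * m)               ≈⟨ at-suc n ⟩
    Z (suc n) +ₚ T *ₚ X (n * m) ≈⟨ +ₚ-cong (≈-sym (W.below (suc n) 1+n<e)) (*ₚ-congʳ T (≈-sym (Y≈X n<e))) ⟩
    W (suc n) +ₚ T *ₚ Y (n * m) ∎
  ... | inj₂ refl = begin
    Y (suc n * m)                                 ≡⟨ cong Y (sym (ℕP.+-identityʳ (suc n * m))) ⟩
    Y (suc n * m + 0)                             ≈⟨ Y.step 0 ⟩
    X (suc n * m + 0) +ₚ t *ₚ Y 0                 ≡⟨ cong (λ x → X x +ₚ t *ₚ Y 0) (ℕP.+-identityʳ (suc n * m)) ⟩
    X (suc n * m) +ₚ t *ₚ Y 0                     ≈⟨ +ₚ-cong (at-suc n) (*ₚ-congʳ t dilatedQuotient-zero) ⟩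
    (Z (suc n) +ₚ T *ₚ X (n * m)) +ₚ t *ₚ W 0     ≈⟨ swap (Z (suc n)) T (X (n * m)) t (W 0) ⟩
    (Z (suc n) +ₚ t *ₚ W 0) +ₚ T *ₚ X (n * m)     ≡⟨ cong (λ x → (Z x +ₚ t *ₚ W 0) +ₚ T *ₚ X (n * m)) (sym (ℕP.+-identityʳ (suc n))) ⟩
    (Z (suc n + 0) +ₚ t *ₚ W 0) +ₚ T *ₚ X (n * m) ≈⟨ +ₚ-cong (≈-sym (W.step 0)) (*ₚ-congʳ T (≈-sym (Y≈X n<e))) ⟩
    W (suc n + 0) +ₚ T *ₚ Y (n * m)               ≡⟨ cong (λ x → W x +ₚ T *ₚ Y (n * m)) (ℕP.+-identityʳ (suc n)) ⟩
    W (suc n) +ₚ T *ₚ Y (n * m)                   ∎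
    where
    swap : ∀ z u x s w → (z +ₚ u *ₚ x) +ₚ s *ₚ w ≈ (z +ₚ s *ₚ w) +ₚ u *ₚ x
    swap = solve-∀ ℤ[t]-solver

  dilatedQuotient-stride : ∀ n → Y (suc n * m) ≈ W (suc n) +ₚ T *ₚ Y (n * m) →
    Y (suc (e + n) * m) ≈ W (suc (e + n)) +ₚ T *ₚ Y ((e + n) * m)
  dilatedQuotient-stride n ih = begin
    Y (suc (e + n) * m)                                          ≡⟨ cong Y index-suc ⟩
    Y (e * m + suc n * m)                                        ≈⟨ Y.step (suc n * m) ⟩
    X (e * m + suc n * m) +ₚ t *ₚ Y (suc n * m)                  ≡⟨ cong (λ x → X x +ₚ t *ₚ Y (suc n * m)) (sym index-suc) ⟩
    X (suc (e + n) * m) +ₚ t *ₚ Y (suc n * m)                    ≈⟨ +ₚ-cong (at-suc (e + n)) (*ₚ-congʳ t ih) ⟩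
    (Z (suc (e + n)) +ₚ T *ₚ X ((e + n) * m)) +ₚ t *ₚ (W (suc n) +ₚ T *ₚ Y (n * m))
      ≈⟨ regroup (Z (suc (e + n))) T (X ((e + n) * m)) t (W (suc n)) (Y (n * m)) ⟩
    (Z (suc (e + n)) +ₚ t *ₚ W (suc n)) +ₚ T *ₚ (X ((e + n) * m) +ₚ t *ₚ Y (n * m))
      ≡⟨ cong₂ (λ x y → (Z x +ₚ t *ₚ W (suc n)) +ₚ T *ₚ (X y +ₚ t *ₚ Y (n * m))) (sym (ℕP.+-suc e n)) index ⟩
    (Z (e + suc n) +ₚ t *ₚ W (suc n)) +ₚ T *ₚ (X (e * m + n * m) +ₚ t *ₚ Y (n * m))
      ≈⟨ +ₚ-cong (≈-sym (W.step (suc n))) (*ₚ-congʳ T (≈-sym (Y.step (n * m)))) ⟩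
    W (e + suc n) +ₚ T *ₚ Y (e * m + n * m)                      ≡⟨ cong₂ (λ x y → W x +ₚ T *ₚ Y y) (ℕP.+-suc e n) (sym index) ⟩
    W (suc (e + n)) +ₚ T *ₚ Y ((e + n) * m)                      ∎
    where
    index : (e + n) * m ≡ e * m + n * m
    index = ℕP.*-distribʳ-+ m e n
    index-suc : suc (e + n) * m ≡ e * m + suc n * m
    index-suc = trans (cong (_* m) (sym (ℕP.+-suc e n))) (ℕP.*-distribʳ-+ m e (suc n))
    regroup : ∀ z u x s w y → (z +ₚ u *ₚ x) +ₚ s *ₚ (w +ₚ u *ₚ y) ≈ (z +ₚ s *ₚ w) +ₚ u *ₚ (x +ₚ s *ₚ y)
    regroup = solve-∀ ℤ[t]-solver

  geomQuotient-dilatedQuotient : DilatedQuotient m W Y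
  geomQuotient-dilatedQuotient = record
    { at-zero = dilatedQuotient-zero
    ; at-suc  = stride-induction _ 0<e dilatedQuotient-below dilatedQuotient-stride }

-- Truncated products

open CommSemigroupProperties ℕP.*-commutativeSemigroup using (xy∙z≈xz∙y)

-- ∏_{i<j} 1/(1 - t q^{N_i})
prodGeomBelow : (ℕ → ℕ) → ℕ → Series
prodGeomBelow N zero    = 1ₛ
prodGeomBelow N (suc j) = prodGeom N j

module Products {N : ℕ → ℕ} (N₀≡1 : N 0 ≡ 1) (N-grows : ∀ i → 2 ≤ N (suc i)) where

  Nprod-≥ : ∀ j → suc j ≤ Nprod N j
  Nprod-≥ zero    = ℕP.≤-reflexive (sym N₀≡1)
  Nprod-≥ (suc j) = ℕP.≤-trans (s≤s (s≤s (ℕP.m≤m*n j 2))) (ℕP.*-mono-≤ (Nprod-≥ j) (N-grows j))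

  Nprod-positive : ∀ j → 0 < Nprod N j
  Nprod-positive j = ℕP.≤-trans (s≤s z≤n) (Nprod-≥ j)

  prodGeom-geomQuotient : ∀ j → GeomQuotient (Nprod N (suc j)) (prodGeom N j) (prodGeom N (suc j))
  prodGeom-geomQuotient j = *ₛ-geomS-geomQuotient (Nprod-positive (suc j)) (prodGeom N j)

  prodGeomBelow-geomQuotient : ∀ j → GeomQuotient (Nprod N j) (prodGeomBelow N j) (prodGeomBelow N (suc j))
  prodGeomBelow-geomQuotient zero    = geomS-geomQuotient (Nprod-positive 0)
  prodGeomBelow-geomQuotient (suc j) = prodGeom-geomQuotient j

  prodGeom-stable : ∀ j {x} → x ≤ j → prodGeom N j x ≈ pN N x
  prodGeom-stable zero    z≤n   = ≈-refl
  prodGeom-stable (suc j) {x} x≤1+j with ℕP.m≤n⇒m<n∨m≡n x≤1+j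
  ... | inj₂ refl      = ≈-refl
  ... | inj₁ (s≤s x≤j) = ≈-trans
    (GeomQuotient.below (prodGeom-geomQuotient j) x (ℕP.<-trans (s≤s x≤j) (Nprod-≥ (suc j))))
    (prodGeom-stable j x≤j)

  N₁∣Nprod : ∀ j → N 1 ∣ Nprod N (suc j)
  N₁∣Nprod zero    = n∣m*n (N 0)
  N₁∣Nprod (suc j) = ∣m⇒∣m*n (N (suc (suc j))) (N₁∣Nprod j)

  prodGeom-blockGeometric : ∀ j → BlockGeometric (N 1) (prodGeom N j)
  prodGeom-blockGeometric zero    =
    subst (λ d → BlockGeometric (N 1) (geomS d)) (sym N₀≡1) (geomS-1-blockGeometric (N 1))
  prodGeom-blockGeometric (suc j) = geomQuotient-blockGeometric (N₁∣Nprod j) (Nprod-positive (suc j))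
    (prodGeom-geomQuotient j) (prodGeom-blockGeometric j)

  pN-blockGeometric : BlockGeometric (N 1) (pN N)
  pN-blockGeometric k r r<N₁ = ≈-trans (≈-sym (prodGeom-stable J ℕP.≤-refl))
    (≈-trans (prodGeom-blockGeometric J k r r<N₁)
             (*ₚ-congʳ (tpow r) (prodGeom-stable J (ℕP.m≤m+n (k * N 1) r))))
    where J = k * N 1 + r

module _ {N : ℕ → ℕ} (N₀≡1 : N 0 ≡ 1) (N-grows : ∀ i → 2 ≤ N (suc i)) where

  private
    module P  = Products {N} N₀≡1 N-grows
    module P′ = Products {shiftSeq N} refl (N-grows ∘ suc)

  Nprod-shiftSeq : ∀ j → Nprod N (suc j) ≡ Nprod (shiftSeq N) j * N 1
  Nprod-shiftSeq zero    = cong (_* N 1) N₀≡1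
  Nprod-shiftSeq (suc j) =
    trans (cong (_* N (suc (suc j))) (Nprod-shiftSeq j)) (xy∙z≈xz∙y (Nprod (shiftSeq N) j) (N 1) _)

  prodGeom-dilatedQuotient : ∀ j → DilatedQuotient (N 1) (prodGeomBelow (shiftSeq N) j) (prodGeom N j)
  prodGeom-dilatedQuotient zero    =
    subst (λ d → DilatedQuotient (N 1) 1ₛ (geomS d)) (sym N₀≡1) (geomS-1-dilatedQuotient (N 1))
  prodGeom-dilatedQuotient (suc j) = geomQuotient-dilatedQuotient
    (ℕP.≤-trans (s≤s z≤n) (N-grows 0)) (P′.Nprod-positive j)
    (subst (λ d → GeomQuotient d (prodGeom N j) (prodGeom N (suc j))) (Nprod-shiftSeq j) (P.prodGeom-geomQuotient j))
    (P′.prodGeomBelow-geomQuotient j) (prodGeom-dilatedQuotient j)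

  pN-dilatedQuotient : DilatedQuotient (N 1) (pN (shiftSeq N)) (pN N)
  pN-dilatedQuotient = record
    { at-zero = ≈-trans (geomS-zero (P.Nprod-positive 0)) (≈-sym (geomS-zero {1} (s≤s z≤n)))
    ; at-suc  = at-suc }
    where
    at-suc : ∀ n → pN N (suc n * N 1) ≈ pN (shiftSeq N) (suc n) +ₚ tpow (N 1) *ₚ pN N (n * N 1)
    at-suc n = ≈-trans (≈-sym (P.prodGeom-stable J ≤J))
      (≈-trans (DilatedQuotient.at-suc (prodGeom-dilatedQuotient J) n)
               (+ₚ-cong (P′.prodGeom-stable _ (ℕP.m≤m+n (suc n) _))
                        (*ₚ-congʳ (tpow (N 1)) (P.prodGeom-stable J (ℕP.≤-trans (ℕP.m≤n+m (n * N 1) (N 1)) ≤J)))))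
      where
      J = suc (suc n + suc n * N 1)
      ≤J : suc n * N 1 ≤ J
      ≤J = ℕP.m≤n⇒m≤1+n (ℕP.m≤n+m (suc n * N 1) (suc n))

module _ {s m₂′ : ℕ} {Z X : Series} (X≡Z↑ : DilatedQuotient (suc s) Z X) (Z-block : BlockGeometric (suc m₂′) Z)
         where

  private
    m₁ = suc s
    m₂ = suc m₂′
    T = tpow m₁
    Q = tpow (s + m₂) *ₚ fgeom m₂ s
    open DilatedQuotient X≡Z↑
    open Relation.Binary.Reasoning.Preorder (≡-mod-preorder Q)

    unit : ∀ z → z ≈ tpow 0 *ₚ fgeom 1 s *ₚ z
    unit z = ≈-sym (≈-trans (*ₚ-congˡ z (*ₚ-congʳ 1ₚ (fgeom-1 s))) (identity z))
      where
      identity : ∀ z → 1ₚ *ₚ 1ₚ *ₚ z ≈ z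
      identity = solve-∀ ℤ[t]-solver

  Congruent : ℕ → ℕ → Set
  Congruent k r = X ((k * m₂ + r) * m₁) ≡ tpow r *ₚ fgeom (suc r) s *ₚ Z (k * m₂) [mod Q ]

  congruent-zero : Congruent 0 0
  congruent-zero = begin
    X 0                        ≈⟨ at-zero ⟩
    Z 0                        ≈⟨ unit (Z 0) ⟩
    tpow 0 *ₚ fgeom 1 s *ₚ Z 0 ∎

  congruent-suc-residue : ∀ k r → suc r < m₂ → Congruent k r → Congruent k (suc r)
  congruent-suc-residue k r 1+r<m₂ ih = begin
    X ((k * m₂ + suc r) * m₁)                                   ≡⟨ cong (λ x → X (x * m₁)) (ℕP.+-suc (k * m₂) r) ⟩
    X (suc (k * m₂ + r) * m₁)                                   ≈⟨ at-suc (k * m₂ + r) ⟩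
    Z (suc (k * m₂ + r)) +ₚ T *ₚ X ((k * m₂ + r) * m₁)          ≲⟨ ≡-mod-+ₚ-congʳ (Z (suc (k * m₂ + r))) (≡-mod-*ₚ-congʳ T ih) ⟩
    Z (suc (k * m₂ + r)) +ₚ T *ₚ (tpow r *ₚ F *ₚ Zₖ)            ≡⟨ cong (λ x → Z x +ₚ T *ₚ (tpow r *ₚ F *ₚ Zₖ)) (sym (ℕP.+-suc (k * m₂) r)) ⟩
    Z (k * m₂ + suc r) +ₚ T *ₚ (tpow r *ₚ F *ₚ Zₖ)              ≈⟨ +ₚ-cong (Z-block k (suc r) 1+r<m₂) (*ₚ-congˡ _ (tpow-suc s)) ⟩
    tpow (suc r) *ₚ Zₖ +ₚ (t *ₚ tpow s) *ₚ (tpow r *ₚ F *ₚ Zₖ)  ≈⟨ +ₚ-congˡ _ (*ₚ-congˡ Zₖ (tpow-suc r)) ⟩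
    (t *ₚ tpow r) *ₚ Zₖ +ₚ (t *ₚ tpow s) *ₚ (tpow r *ₚ F *ₚ Zₖ) ≈⟨ absorb t (tpow r) (tpow s) F Zₖ ⟩
    (t *ₚ tpow r) *ₚ (1ₚ +ₚ tpow s *ₚ F) *ₚ Zₖ                  ≈⟨ *ₚ-congˡ Zₖ (*ₚ-cong (≈-sym (tpow-suc r)) (≈-sym (fgeom-suc (suc r) s))) ⟩
    tpow (suc r) *ₚ fgeom (suc (suc r)) s *ₚ Zₖ                 ∎
    where
    F  = fgeom (suc r) s
    Zₖ = Z (k * m₂)
    absorb : ∀ t u v f z → (t *ₚ u) *ₚ z +ₚ (t *ₚ v) *ₚ (u *ₚ f *ₚ z) ≈ (t *ₚ u) *ₚ (1ₚ +ₚ v *ₚ f) *ₚ z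
    absorb = solve-∀ ℤ[t]-solver

  congruent-suc-block : ∀ k → Congruent k m₂′ → Congruent (suc k) 0
  congruent-suc-block k ih = begin
    X ((suc k * m₂ + 0) * m₁)                                ≡⟨ cong (λ x → X (x * m₁)) index ⟩
    X (suc (k * m₂ + m₂′) * m₁)                              ≈⟨ at-suc (k * m₂ + m₂′) ⟩
    Z (suc (k * m₂ + m₂′)) +ₚ T *ₚ X ((k * m₂ + m₂′) * m₁)   ≲⟨ ≡-mod-+ₚ-congʳ (Z (suc (k * m₂ + m₂′))) (≡-mod-*ₚ-congʳ T ih) ⟩
    Z (suc (k * m₂ + m₂′)) +ₚ T *ₚ (tpow m₂′ *ₚ F *ₚ Zₖ)     ≈⟨ +ₚ-congʳ _ (≈-trans (reassoc T (tpow m₂′) F Zₖ) (*ₚ-congˡ Zₖ (*ₚ-congˡ F T*tpow))) ⟩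
    Z (suc (k * m₂ + m₂′)) +ₚ Q *ₚ Zₖ                        ≲⟨ +ₚ-multiple-≡-mod _ Zₖ ⟩
    Z (suc (k * m₂ + m₂′))                                   ≡⟨ cong Z (sym index) ⟩
    Z (suc k * m₂ + 0)                                       ≡⟨ cong Z (ℕP.+-identityʳ (suc k * m₂)) ⟩
    Z (suc k * m₂)                                           ≈⟨ unit _ ⟩
    tpow 0 *ₚ fgeom 1 s *ₚ Z (suc k * m₂)                    ∎
    where
    F  = fgeom m₂ s
    Zₖ = Z (k * m₂)
    index : suc k * m₂ + 0 ≡ suc (k * m₂ + m₂′)
    index = trans (ℕP.+-identityʳ (suc k * m₂)) (cong suc (ℕP.+-comm m₂′ (k * m₂)))
    reassoc : ∀ t u f z → t *ₚ (u *ₚ f *ₚ z) ≈ (t *ₚ u) *ₚ f *ₚ z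
    reassoc = solve-∀ ℤ[t]-solver
    T*tpow : T *ₚ tpow m₂′ ≈ tpow (s + m₂)
    T*tpow = ≈-trans (≈-sym (tpow-+ m₁ m₂′)) (≈-reflexive (cong tpow (sym (ℕP.+-suc s m₂′))))

  congruent : ∀ k r → r < m₂ → Congruent k r
  congruent zero    zero    _      = congruent-zero
  congruent k       (suc r) 1+r<m₂ = congruent-suc-residue k r 1+r<m₂ (congruent k r (ℕP.<⇒≤ 1+r<m₂))
  congruent (suc k) zero    _      = congruent-suc-block k (congruent k m₂′ ℕP.≤-refl)

dilatedQuotient-congruence : ∀ {m₁ m₂ Z X} → 0 < m₁ → 0 < m₂ →
  DilatedQuotient m₁ Z X → BlockGeometric m₂ Z → ∀ k r → r < m₂ →
  X ((k * m₂ + r) * m₁)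
    ≡ tpow r *ₚ fgeom (suc r) (m₁ ∸ 1) *ₚ Z (k * m₂) [mod tpow (m₁ + m₂ ∸ 1) *ₚ fgeom m₂ (m₁ ∸ 1) ]
dilatedQuotient-congruence {suc _} {suc _} _ _ = congruent

lemma5p1 : (M : ℕ → ℕ) → M 0 ≡ 1 → (∀ i → 2 ≤ M (suc i)) →
    (n k r : ℕ) → r < M 2 → n ≡ k * M 2 + r →
    pN M (M 1 * n)
      ≡ tpow r *ₚ fgeom (suc r) (M 1 ∸ 1) *ₚ pN (shiftSeq M) (k * M 2)
      [modₚ tpow (M 1 + M 2 ∸ 1) *ₚ fgeom (M 2) (M 1 ∸ 1) ]
lemma5p1 M M₀≡1 M-grows n k r r<M₂ refl rewrite ℕP.*-comm (M 1) (k * M 2 + r) =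
  ≡[mod]⇒≡[modₚ] (dilatedQuotient-congruence 0<M₁ 0<M₂ (pN-dilatedQuotient M₀≡1 M-grows)
    (Products.pN-blockGeometric {shiftSeq M} refl (M-grows ∘ suc)) k r r<M₂)
  where
  0<M₁ = ℕP.≤-trans (s≤s z≤n) (M-grows 0)
  0<M₂ = ℕP.≤-trans (s≤s z≤n) (M-grows 1)
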